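{- Let $p$ be a positive integer and let $H$ be a connected graph with $2p$ vertices. Then for every integer $r \geq \lceil \log p \rceil$, $mw(T_r(H)) \geq (r+1-\lceil \log p \rceil)\,p/2$.
   Context: Logarithms are base 2. $T_r$ is the complete binary tree of height (root-leaf distance) $r$. For a tree $T$ and a graph $H$, $T(H)$ is the graph consisting of pairwise disjoint copies of $H$, one copy $H_t$ for each vertex $t$ of $T$, with the edges of each copy, and, for each edge $\{t_1,t_2\}$ of $T$ and each vertex $w$ of $H$, an edge joining the copy of $w$ in $H_{t_1}$ to the copy of $w$ in $H_{t_2}$. Matching width: for a permutation $SV$ of $V(G)$ and a prefix $S_1$ of $SV$, the matching width of $S_1$ is the size of a largest matching of edges between $S_1$ and $V(G)\setminus S_1$; the matching width of $SV$ is the maximum over its prefixes; $mw(G)$ is the minimum over all permutations of $V(G)$. -}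

module Defs where

open import Data.Nat using (ℕ; _≤_; _*_)
open import Data.Bool using (Bool)
open import Data.List using (List; []; _∷_; length; take; drop; concatMap)
open import Data.List.Membership.Propositional using (_∈_)
open import Data.List.Relation.Unary.All using (All)
open import Data.List.Relation.Unary.Unique.Propositional using (Unique)
open import Data.Product using (Σ; _×_; _,_; ∃; ∃-syntax)
open import Data.Sum using (_⊎_)
open import Relation.Binary.PropositionalEquality using (_≡_)
open import Relation.Nullary using (¬_)

record Graph : Set₁ where
  field
    V : Set
    E : V → V → Set
open Graph public

IsSimple : Graph → Set
IsSimple G = (∀ u v → E G u v → E G v u) × (∀ u → ¬ E G u u)

HasOrder : Graph → ℕ → Set
HasOrder G n = Σ (List (V G)) λ vs → Unique vs × (∀ v → v ∈ vs) × length vs ≡ n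

data Walk (G : Graph) : V G → V G → Set where
  here : ∀ {u} → Walk G u u
  step : ∀ {u w v} → E G u w → Walk G w v → Walk G u v

Connected : Graph → Set
Connected G = ∀ u v → Walk G u v

-- complete binary tree T_r of height r: vertices are bit strings of length ≤ r
-- (the root is []), and s is joined to b ∷ s for each bit b
TreeV : ℕ → Set
TreeV r = Σ (List Bool) λ s → length s ≤ r

TreeE : (r : ℕ) → TreeV r → TreeV r → Set
TreeE r (s , _) (t , _) = (∃[ b ] t ≡ b ∷ s) ⊎ (∃[ b ] s ≡ b ∷ t)

CBT : ℕ → Graph
CBT r = record { V = TreeV r ; E = TreeE r }

-- T(H): copies H_t of H for t ∈ V(T); copy of w in H_{t1} joined to copy of w in H_{t2}
-- whenever {t1,t2} ∈ E(T)
TreeProd : Graph → Graph → Graph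
TreeProd T H = record
  { V = V T × V H
  ; E = λ { (t₁ , w₁) (t₂ , w₂) → (t₁ ≡ t₂ × E H w₁ w₂) ⊎ (E T t₁ t₂ × w₁ ≡ w₂) } }

IsPermutation : (G : Graph) → List (V G) → Set
IsPermutation G σ = Unique σ × (∀ v → v ∈ σ)

endpoints : {A : Set} → List (A × A) → List A
endpoints = concatMap λ { (u , v) → u ∷ v ∷ [] }

IsCrossMatching : (G : Graph) → List (V G) → List (V G) → List (V G × V G) → Set
IsCrossMatching G S T M =
  All (λ { (u , v) → u ∈ S × v ∈ T × E G u v }) M × Unique (endpoints M)

-- mw(G) ≥ q / 2 (rational bound written without division):
-- for every permutation σ there is a prefix S₁ = take k σ (complement drop k σ)
-- admitting a matching M across it with q ≤ 2 * |M|.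
MwAtLeastHalfOf : Graph → ℕ → Set
MwAtLeastHalfOf G q =
  ∀ σ → IsPermutation G σ →
    ∃[ k ] ∃[ M ] IsCrossMatching G (take k σ) (drop k σ) M × q ≤ 2 * length M

-- Fix an ordering σ of V(T_r(H)) and a node g of T_r. While σ is scanned, the number of w ∈ V(H)
-- with some copy (t, w), t below g, already scanned grows from 0 to 2p in unit steps, so some prefix
-- of σ leaves p such w on each side below g. Given p nodes of a region below g, either every copy of H
-- at them is split by the prefix, giving a crossing edge inside each copy as H is connected, or one copy
-- lies wholly on one side, and then each of the p values w met on the other side gives a crossing edge
-- of the fibre T_r × {w} on the tree path through the region: p disjoint crossing edges either way.
-- Going up two levels at a time, among three grandchildren of s take the one whose balanced prefix is
-- the middle one: its matching, plus p edges in the rest of the subtree of s fed by the earlier and the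
-- later grandchild, raises the matching by p. This works while subtrees still have p nodes ⌈log p⌉
-- levels down, so over r + 1 − ⌈log p⌉ levels.

module Submission where

open import Defs
open import Data.Bool using (Bool; true; false)
import Data.Bool.Properties as Bool
open import Data.Nat
  using (ℕ; zero; suc; _+_; _*_; _∸_; _⊓_; _^_; _≤_; _<_; z≤n; s≤s; _≤?_; ⌈_/2⌉; ⌊_/2⌋)
open import Data.Nat.Properties
open import Data.Nat.Tactic.RingSolver using (solve-∀)
open import Data.Nat.Logarithm using (⌈log₂_⌉)
open import Data.Nat.Logarithm.Core using (⌈log2⌉)
open import Data.Nat.Induction using (<-wellFounded)
open import Induction.WellFounded using (Acc; acc)
open import Data.List using (List; []; _∷_; length; take; drop; _++_; filter)
open import Data.List.Properties
  using (≡-dec; length-++; length-take; take++drop≡id; take-all; filter-all; filter-none; concatMap-++)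
import Data.List.Relation.Unary.All.Properties as AllP
import Data.List.Relation.Unary.Unique.Propositional.Properties as UP
open import Data.List.Membership.Propositional using (_∈_; find; lose)
open import Data.List.Relation.Binary.Disjoint.Propositional using (Disjoint)
open import Data.List.Membership.Propositional.Properties using (∈-++⁻; ∈-++⁺ʳ; ∈-filter⁻)
open import Data.List.Relation.Unary.Any as Any using (Any; here; there)
import Data.List.Relation.Unary.Any.Properties as Any
open import Data.List.Relation.Unary.All as All using (All; []; _∷_)
open import Data.List.Relation.Unary.AllPairs using ([]; _∷_)
open import Data.List.Relation.Unary.Unique.Propositional using (Unique)
open import Data.Product using (Σ; _×_; _,_; ∃-syntax; proj₁; proj₂)
open import Data.Sum as Sum using (_⊎_; inj₁; inj₂)
open import Data.Empty using (⊥; ⊥-elim)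
open import Relation.Nullary using (¬_; Dec; yes; no; ¬?; _×-dec_)
open import Relation.Unary using (Pred; Decidable)
open import Level using (0ℓ)
open import Function using (_∘_)
open import Relation.Binary.PropositionalEquality
  using (_≡_; _≢_; refl; sym; trans; cong; cong₂; subst; module ≡-Reasoning)

module _ {A : Set} where

  ∈-take-mono : ∀ {k k'} (xs : List A) {x} → k ≤ k' → x ∈ take k xs → x ∈ take k' xs
  ∈-take-mono (_ ∷ xs) (s≤s _) (here refl) = here refl
  ∈-take-mono (_ ∷ xs) (s≤s k≤k') (there x∈) = there (∈-take-mono xs k≤k' x∈)

  ∈-drop⇒∈ : ∀ k (xs : List A) {x} → x ∈ drop k xs → x ∈ xs
  ∈-drop⇒∈ zero xs x∈ = x∈
  ∈-drop⇒∈ (suc k) (_ ∷ xs) x∈ = there (∈-drop⇒∈ k xs x∈)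

  ∈-drop-antimono : ∀ {k k'} (xs : List A) {x} → k ≤ k' → x ∈ drop k' xs → x ∈ drop k xs
  ∈-drop-antimono {zero} {k'} xs _ x∈ = ∈-drop⇒∈ k' xs x∈
  ∈-drop-antimono {suc k} (_ ∷ xs) (s≤s k≤k') x∈ = ∈-drop-antimono xs k≤k' x∈

  ∈-take⊎∈-drop : ∀ k (xs : List A) {x} → x ∈ xs → x ∈ take k xs ⊎ x ∈ drop k xs
  ∈-take⊎∈-drop k xs x∈ = ∈-++⁻ (take k xs) (subst (_ ∈_) (sym (take++drop≡id k xs)) x∈)

  unique-++-disjoint : ∀ (xs : List A) {ys x} → Unique (xs ++ ys) → x ∈ xs → x ∈ ys → ⊥
  unique-++-disjoint (_ ∷ xs) (x∉ ∷ _) (here refl) x∈ys = All.lookup x∉ (∈-++⁺ʳ xs x∈ys) refl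
  unique-++-disjoint (_ ∷ xs) (_ ∷ u) (there x∈xs) x∈ys = unique-++-disjoint xs u x∈xs x∈ys

  unique-take-drop-disjoint : ∀ k {xs : List A} {x} → Unique xs → x ∈ take k xs → x ∈ drop k xs → ⊥
  unique-take-drop-disjoint k {xs} u =
    unique-++-disjoint (take k xs) (subst Unique (sym (take++drop≡id k xs)) u)

  take-suc-++ : ∀ k (xs : List A) → take (suc k) xs ≡ take k xs ++ take 1 (drop k xs)
  take-suc-++ zero [] = refl
  take-suc-++ zero (x ∷ xs) = refl
  take-suc-++ (suc k) [] = refl
  take-suc-++ (suc k) (x ∷ xs) = cong (x ∷_) (take-suc-++ k xs)

  ∈-take-1-unique : ∀ (xs : List A) {x y} → x ∈ take 1 xs → y ∈ take 1 xs → x ≡ y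
  ∈-take-1-unique (_ ∷ _) (here refl) (here refl) = refl

  unique-enumeration-≟ : ∀ {vs : List A} → Unique vs → ∀ {u v} → u ∈ vs → v ∈ vs → Dec (u ≡ v)
  unique-enumeration-≟ _ (here refl) (here refl) = yes refl
  unique-enumeration-≟ (v∉ ∷ _) (here refl) (there v∈) = no (All.lookup v∉ v∈)
  unique-enumeration-≟ (u∉ ∷ _) (there u∈) (here refl) = no (λ u≡v → All.lookup u∉ u∈ (sym u≡v))
  unique-enumeration-≟ (_ ∷ vs!) (there u∈) (there v∈) = unique-enumeration-≟ vs! u∈ v∈

  module _ {P Q : Pred A 0ℓ} (P? : Decidable P) (Q? : Decidable Q) where

    length-filter-mono : ∀ (xs : List A) → (∀ {x} → x ∈ xs → P x → Q x) →
      length (filter P? xs) ≤ length (filter Q? xs)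
    length-filter-mono [] _ = z≤n
    length-filter-mono (x ∷ xs) P⇒Q with P? x | Q? x
    ... | yes _  | yes _ = s≤s (length-filter-mono xs (λ x∈ → P⇒Q (there x∈)))
    ... | yes px | no ¬qx = ⊥-elim (¬qx (P⇒Q (here refl) px))
    ... | no _   | yes _ = m≤n⇒m≤1+n (length-filter-mono xs (λ x∈ → P⇒Q (there x∈)))
    ... | no _   | no _ = length-filter-mono xs (λ x∈ → P⇒Q (there x∈))

    length-filter-≤-suc : ∀ {xs : List A} {E : Pred A 0ℓ} → Unique xs →
      (∀ {x} → P x → Q x ⊎ E x) → (∀ {x y} → E x → E y → x ≡ y) →
      length (filter P? xs) ≤ suc (length (filter Q? xs))
    length-filter-≤-suc {[]} _ _ _ = z≤n
    length-filter-≤-suc {x ∷ xs} {E} (x∉ ∷ xs!) P⇒Q⊎E E-unique with P? x | Q? x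
    ... | yes _  | yes _ = s≤s (length-filter-≤-suc xs! P⇒Q⊎E E-unique)
    ... | no _   | yes _ = m≤n⇒m≤1+n (length-filter-≤-suc xs! P⇒Q⊎E E-unique)
    ... | no _   | no _ = length-filter-≤-suc xs! P⇒Q⊎E E-unique
    ... | yes px | no ¬qx = s≤s (length-filter-mono xs P⇒Q)
      where
      ex : E x
      ex with P⇒Q⊎E px
      ... | inj₁ qx = ⊥-elim (¬qx qx)
      ... | inj₂ ex = ex
      P⇒Q : ∀ {y} → y ∈ xs → P y → Q y
      P⇒Q y∈ py with P⇒Q⊎E py
      ... | inj₁ qy = qy
      ... | inj₂ ey = ⊥-elim (All.lookup x∉ y∈ (E-unique ex ey))

  module _ {P : Pred A 0ℓ} (P? : Decidable P) where

    length-filter+length-filter-¬ : ∀ (xs : List A) →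
      length (filter P? xs) + length (filter (¬? ∘ P?) xs) ≡ length xs
    length-filter+length-filter-¬ [] = refl
    length-filter+length-filter-¬ (x ∷ xs) with P? x
    ... | yes _ = cong suc (length-filter+length-filter-¬ xs)
    ... | no _ = trans (+-suc _ _) (cong suc (length-filter+length-filter-¬ xs))

unit-step-ivt : ∀ (f : ℕ → ℕ) → f 0 ≡ 0 → (∀ k → f (suc k) ≤ suc (f k)) →
  ∀ {n} N → n ≤ f N → ∃[ k ] f k ≡ n
unit-step-ivt f f0≡0 _ zero n≤f0 = 0 , trans f0≡0 (sym (n≤0⇒n≡0 (subst (_ ≤_) f0≡0 n≤f0)))
unit-step-ivt f f0≡0 f-step {n} (suc N) n≤fN+1 with n ≤? f N
... | yes n≤fN = unit-step-ivt f f0≡0 f-step N n≤fN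
... | no n≰fN = suc N , ≤-antisym (≤-trans (f-step N) (≰⇒> n≰fN)) n≤fN+1


median-of-three : ∀ {A : Set} (key : A → ℕ) (D : A → A → Set) → (∀ {x y} → D x y → D y x) →
  ∀ {x y z} → D x y → D y z → D x z →
  ∃[ a ] ∃[ m ] ∃[ b ] (D a m × D b m × key a ≤ key m × key m ≤ key b)
median-of-three key D D-sym {x} {y} {z} Dxy Dyz Dxz
  with ≤-total (key x) (key y) | ≤-total (key y) (key z) | ≤-total (key x) (key z)
... | inj₁ x≤y | inj₁ y≤z | _        = x , y , z , Dxy , D-sym Dyz , x≤y , y≤z
... | inj₁ x≤y | inj₂ z≤y | inj₁ x≤z = x , z , y , Dxz , Dyz , x≤z , z≤y
... | inj₁ x≤y | inj₂ z≤y | inj₂ z≤x = z , x , y , D-sym Dxz , D-sym Dxy , z≤x , x≤y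
... | inj₂ y≤x | inj₁ y≤z | inj₁ x≤z = y , x , z , D-sym Dxy , D-sym Dxz , y≤x , x≤z
... | inj₂ y≤x | inj₁ y≤z | inj₂ z≤x = y , z , x , Dyz , Dxz , y≤z , z≤x
... | inj₂ y≤x | inj₂ z≤y | _        = z , y , x , D-sym Dyz , Dxy , z≤y , y≤x

n≤2^⌈log₂n⌉ : ∀ n → n ≤ 2 ^ ⌈log₂ n ⌉
n≤2^⌈log₂n⌉ n = bound n (<-wellFounded n)
  where
  open ≤-Reasoning
  n≤2*⌈n/2⌉ : ∀ n → n ≤ 2 * ⌈ n /2⌉
  n≤2*⌈n/2⌉ n = begin
    n                        ≡⟨ sym (⌊n/2⌋+⌈n/2⌉≡n n) ⟩
    ⌊ n /2⌋ + ⌈ n /2⌉        ≤⟨ +-monoˡ-≤ ⌈ n /2⌉ (⌊n/2⌋≤⌈n/2⌉ n) ⟩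
    ⌈ n /2⌉ + ⌈ n /2⌉        ≡⟨ cong (⌈ n /2⌉ +_) (sym (+-identityʳ ⌈ n /2⌉)) ⟩
    2 * ⌈ n /2⌉              ∎
  bound : ∀ n (acc : Acc _<_ n) → n ≤ 2 ^ ⌈log2⌉ n acc
  bound zero _ = z≤n
  bound (suc zero) _ = s≤s z≤n
  bound (suc (suc n)) (acc rs) = begin
    2 + n                               ≤⟨ +-monoʳ-≤ 2 (n≤2*⌈n/2⌉ n) ⟩
    2 + 2 * ⌈ n /2⌉                     ≡⟨ sym (*-suc 2 ⌈ n /2⌉) ⟩
    2 * suc ⌈ n /2⌉                     ≤⟨ *-monoʳ-≤ 2 (bound (suc ⌈ n /2⌉) (rs _)) ⟩
    2 * 2 ^ ⌈log2⌉ (suc ⌈ n /2⌉) (rs _) ∎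

Distinct : {A : Set} → (A → Set) → ℕ → Set
Distinct {A} P n = Σ (List A) λ xs → Unique xs × length xs ≡ n × All P xs

Distinct-map : ∀ {A : Set} {P Q : A → Set} {n} → (∀ {x} → P x → Q x) → Distinct P n → Distinct Q n
Distinct-map P⇒Q (xs , xs! , |xs| , Pxs) = xs , xs! , |xs| , All.map P⇒Q Pxs

induced : (G : Graph) → (V G → Set) → Graph
induced G Z = record { V = Σ (V G) Z ; E = λ u v → E G (proj₁ u) (proj₁ v) }

walk-crossing : ∀ {G : Graph} {X Y : V G → Set} → (∀ v → X v ⊎ Y v) → (∀ {v} → X v → Y v → ⊥) →
  ∀ {u v} → Walk G u v → X u → Y v → ∃[ x ] ∃[ y ] (E G x y × X x × Y y)
walk-crossing _ X∩Y=∅ here Xu Yu = ⊥-elim (X∩Y=∅ Xu Yu)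
walk-crossing X⊎Y X∩Y=∅ (step {w = w} e walk) Xu Yv with X⊎Y w
... | inj₁ Xw = walk-crossing X⊎Y X∩Y=∅ walk Xw Yv
... | inj₂ Yw = _ , _ , e , Xu , Yw

module _ {A L : Set} (label : A → L) (Q : A × A → Set) where

  LabelledEdge : L → Set
  LabelledEdge ℓ = ∃[ e ] (Q e × label (proj₁ e) ≡ ℓ × label (proj₂ e) ≡ ℓ)

  private
    matching-labelled-in : (∀ {e} → Q e → proj₁ e ≢ proj₂ e) →
      ∀ {ls} → Unique ls → All LabelledEdge ls →
      ∃[ M ] (length M ≡ length ls × All Q M × Unique (endpoints M) ×
              All (λ x → label x ∈ ls) (endpoints M))
    matching-labelled-in _ [] [] = [] , refl , [] , [] , []
    matching-labelled-in Q⇒≢ {ℓ ∷ _} (ℓ∉ ∷ ls!) (((a , b) , q , a↦ℓ , b↦ℓ) ∷ es)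
      with matching-labelled-in Q⇒≢ ls! es
    ... | M , |M| , QM , M! , M↦ls =
      (a , b) ∷ M , cong suc |M| , q ∷ QM ,
      (Q⇒≢ q ∷ All.map (fresh a↦ℓ) M↦ls) ∷ All.map (fresh b↦ℓ) M↦ls ∷ M! ,
      here a↦ℓ ∷ here b↦ℓ ∷ All.map there M↦ls
      where
      fresh : ∀ {z} → label z ≡ ℓ → ∀ {x} → label x ∈ _ → z ≢ x
      fresh z↦ℓ x↦ls refl = All.lookup ℓ∉ x↦ls (sym z↦ℓ)

  matching-of-labels : (∀ {e} → Q e → proj₁ e ≢ proj₂ e) → ∀ {ls} → Unique ls → All LabelledEdge ls →
    ∃[ M ] (length M ≡ length ls × All Q M × Unique (endpoints M))
  matching-of-labels Q⇒≢ ls! es with matching-labelled-in Q⇒≢ ls! es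
  ... | M , |M| , QM , M! , _ = M , |M| , QM , M!

infix 4 _≼_

-- s ≼ t : the node t of T_r lies in the subtree rooted at s, i.e. s is a suffix of t
data _≼_ : List Bool → List Bool → Set where
  ≼-refl : ∀ {s} → s ≼ s
  ≼-step : ∀ {s t b} → s ≼ t → s ≼ b ∷ t

≼-trans : ∀ {s t u} → s ≼ t → t ≼ u → s ≼ u
≼-trans s≼t ≼-refl = s≼t
≼-trans s≼t (≼-step t≼u) = ≼-step (≼-trans s≼t t≼u)

≼-length : ∀ {s t} → s ≼ t → length s ≤ length t
≼-length ≼-refl = ≤-refl
≼-length (≼-step s≼t) = m≤n⇒m≤1+n (≼-length s≼t)

≼-length-≡⇒≡ : ∀ {s t} → s ≼ t → length s ≡ length t → s ≡ t
≼-length-≡⇒≡ ≼-refl _ = refl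
≼-length-≡⇒≡ (≼-step s≼t) eq = ⊥-elim (<-irrefl eq (s≤s (≼-length s≼t)))

≼-ancestors-≡ : ∀ {s s' t} → s ≼ t → s' ≼ t → length s ≡ length s' → s ≡ s'
≼-ancestors-≡ ≼-refl s'≼t eq = sym (≼-length-≡⇒≡ s'≼t (sym eq))
≼-ancestors-≡ (≼-step s≼t) ≼-refl eq = ≼-length-≡⇒≡ (≼-step s≼t) eq
≼-ancestors-≡ (≼-step s≼t) (≼-step s'≼t) eq = ≼-ancestors-≡ s≼t s'≼t eq

_≼?_ : ∀ s t → Dec (s ≼ t)
s ≼? [] with ≡-dec Bool._≟_ s []
... | yes refl = yes ≼-refl
... | no s≢[] = no λ { ≼-refl → s≢[] refl }
s ≼? (b ∷ t) with ≡-dec Bool._≟_ s (b ∷ t)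
... | yes refl = yes ≼-refl
... | no s≢bt with s ≼? t
...   | yes s≼t = yes (≼-step s≼t)
...   | no s⋠t = no λ { ≼-refl → s≢bt refl ; (≼-step s≼t) → s⋠t s≼t }

module _ {R : ℕ} where

  private
    room-below : ∀ n b (s : List Bool) → suc n + length s ≤ R → n + length (b ∷ s) ≤ R
    room-below n b s h = subst (_≤ R) (sym (+-suc n (length s))) h

  Below : List Bool → TreeV R → Set
  Below s t = s ≼ proj₁ t

  descendants : ∀ n (s : List Bool) → n + length s ≤ R → List (TreeV R)
  descendants zero s h = (s , h) ∷ []
  descendants (suc n) s h =
    descendants n (false ∷ s) (room-below n false s h) ++ descendants n (true ∷ s) (room-below n true s h)

  descendants-≼ : ∀ n s h → All (Below s) (descendants n s h)
  descendants-≼ zero s h = ≼-refl ∷ []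
  descendants-≼ (suc n) s h = AllP.++⁺ (All.map (≼-trans (≼-step ≼-refl)) (descendants-≼ n (false ∷ s) _))
                                       (All.map (≼-trans (≼-step ≼-refl)) (descendants-≼ n (true ∷ s) _))

  length-descendants : ∀ n s h → length (descendants n s h) ≡ 2 ^ n
  length-descendants zero s h = refl
  length-descendants (suc n) s h = begin
    length (descendants n (false ∷ s) _ ++ descendants n (true ∷ s) _)
      ≡⟨ length-++ (descendants n (false ∷ s) _) ⟩
    length (descendants n (false ∷ s) _) + length (descendants n (true ∷ s) _)
      ≡⟨ cong₂ _+_ (length-descendants n (false ∷ s) _) (length-descendants n (true ∷ s) _) ⟩
    2 ^ n + 2 ^ n
      ≡⟨ cong (2 ^ n +_) (sym (+-identityʳ (2 ^ n))) ⟩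
    2 ^ suc n ∎
    where open ≡-Reasoning

  descendants-unique : ∀ n s h → Unique (descendants n s h)
  descendants-unique zero s h = [] ∷ []
  descendants-unique (suc n) s h =
    UP.++⁺ (descendants-unique n (false ∷ s) _) (descendants-unique n (true ∷ s) _) disjoint
    where
    disjoint : ∀ {t} → ¬ (t ∈ descendants n (false ∷ s) _ × t ∈ descendants n (true ∷ s) _)
    disjoint (t∈₀ , t∈₁) with ≼-ancestors-≡ (All.lookup (descendants-≼ n (false ∷ s) _) t∈₀)
                                           (All.lookup (descendants-≼ n (true ∷ s) _) t∈₁) refl
    ... | ()

  distinct-descendants : ∀ {p} s → ⌈log₂ p ⌉ + length s ≤ R → Distinct (Below s) p
  distinct-descendants {p} s h =
    take p level , UP.take⁺ p (descendants-unique _ s h) ,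
    trans (length-take p level)
          (trans (cong (p ⊓_) (length-descendants _ s h)) (m≤n⇒m⊓n≡m (n≤2^⌈log₂n⌉ p))) ,
    AllP.take⁺ p (descendants-≼ _ s h)
    where
    level = descendants ⌈log₂ p ⌉ s h

  TreeE-sym : ∀ {a b} → TreeE R a b → TreeE R b a
  TreeE-sym (inj₁ up) = inj₂ up
  TreeE-sym (inj₂ down) = inj₁ down

  record Region : Set₁ where
    field
      Mem : TreeV R → Set
      hub : TreeV R
      hub≼ : ∀ {t} → Mem t → proj₁ hub ≼ proj₁ t
      between : ∀ {t a} → Mem t → proj₁ hub ≼ proj₁ a → proj₁ a ≼ proj₁ t → Mem a

  subtree : TreeV R → Region
  subtree g = record { Mem = Below (proj₁ g) ; hub = g ; hub≼ = λ t∈ → t∈ ; between = λ _ g≼a _ → g≼a }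

  module _ (Rg : Region) where
    open Region Rg

    walk-to-hub : ∀ {t} (t∈ : Mem t) → ∃[ hub∈ ] Walk (induced (CBT R) Mem) (t , t∈) (hub , hub∈)
    walk-to-hub {t} t∈ = climb (proj₂ t) t∈ (hub≼ t∈)
      where
      climb : ∀ {s} (h : length s ≤ R) (s∈ : Mem (s , h)) → proj₁ hub ≼ s →
        ∃[ hub∈ ] Walk (induced (CBT R) Mem) ((s , h) , s∈) (hub , hub∈)
      climb h s∈ ≼-refl with ≤-irrelevant h (proj₂ hub)
      ... | refl = s∈ , here
      climb {b ∷ s} h bs∈ (≼-step hub≼s)
        with climb (≤-trans (n≤1+n _) h) (between bs∈ hub≼s (≼-step ≼-refl)) hub≼s
      ... | hub∈ , walk = hub∈ , step (inj₂ (b , refl)) walk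

module Cuts {H : Graph} (vs : List (V H)) (vs-complete : ∀ w → w ∈ vs) (conn : Connected H)
            {R : ℕ} (σ : List (TreeV R × V H)) (σ! : Unique σ) (σ-complete : ∀ v → v ∈ σ) where

  Meets : (TreeV R → Set) → (TreeV R × V H → Set) → V H → Set
  Meets Z X w = ∃[ t ] (Z t × X (t , w))

  Inside : (TreeV R → Set) → (TreeV R × V H) × (TreeV R × V H) → Set
  Inside Z (u , v) = Z (proj₁ u) × Z (proj₁ v)

  Pre Post : ℕ → TreeV R × V H → Set
  Pre k v = v ∈ take k σ
  Post k v = v ∈ drop k σ

  pre⊎post : ∀ k v → Pre k v ⊎ Post k v
  pre⊎post k v = ∈-take⊎∈-drop k σ (σ-complete v)

  pre∩post=∅ : ∀ {k v} → Pre k v → Post k v → ⊥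
  pre∩post=∅ {k} = unique-take-drop-disjoint k σ!

  pre≢post : ∀ {k u v} → Pre k u → Post k v → u ≢ v
  pre≢post pre post refl = pre∩post=∅ pre post

  pre-mono : ∀ {k k' v} → k ≤ k' → Pre k v → Pre k' v
  pre-mono = ∈-take-mono σ

  post-antimono : ∀ {k k' v} → k ≤ k' → Post k' v → Post k v
  post-antimono = ∈-drop-antimono σ

  CrossEdge : ℕ → (TreeV R × V H) × (TreeV R × V H) → Set
  CrossEdge k (u , v) = Pre k u × Post k v × E (TreeProd (CBT R) H) u v

  CrossMatching : ℕ → List ((TreeV R × V H) × (TreeV R × V H)) → Set
  CrossMatching k = IsCrossMatching (TreeProd (CBT R) H) (take k σ) (drop k σ)

  endpoints-inside : ∀ {Z M} → All (Inside Z) M → All (Z ∘ proj₁) (endpoints M)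
  endpoints-inside [] = []
  endpoints-inside ((u∈ , v∈) ∷ M-inside) = u∈ ∷ v∈ ∷ endpoints-inside M-inside

  crossMatching-++ : ∀ {k M N} → CrossMatching k M → CrossMatching k N →
    Disjoint (endpoints M) (endpoints N) → CrossMatching k (M ++ N)
  crossMatching-++ {M = M} {N} (M-cross , M!) (N-cross , N!) M#N =
    AllP.++⁺ M-cross N-cross , subst Unique (sym (concatMap-++ _ M N)) (UP.++⁺ M! N! M#N)

  inside-disjoint : ∀ {Z Z' M N} → (∀ {t} → Z t → Z' t → ⊥) →
    All (Inside Z) M → All (Inside Z') N → Disjoint (endpoints M) (endpoints N)
  inside-disjoint Z∩Z'=∅ M-inside N-inside (v∈M , v∈N) =
    Z∩Z'=∅ (All.lookup (endpoints-inside M-inside) v∈M) (All.lookup (endpoints-inside N-inside) v∈N)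

  Mixed : ℕ → TreeV R → Set
  Mixed k t = ∃[ w ] ∃[ w' ] (Pre k (t , w) × Post k (t , w'))

  classify : ∀ k t → Mixed k t ⊎ ((∀ w → Pre k (t , w)) ⊎ (∀ w → Post k (t , w)))
  classify k t with All.decide (λ w → pre⊎post k (t , w)) vs
  ... | inj₁ all-pre = inj₂ (inj₁ (λ w → All.lookup all-pre (vs-complete w)))
  ... | inj₂ some-post with All.decide (λ w → Sum.swap (pre⊎post k (t , w))) vs
  ...   | inj₁ all-post = inj₂ (inj₂ (λ w → All.lookup all-post (vs-complete w)))
  ...   | inj₂ some-pre = inj₁ (_ , _ , proj₂ (Any.satisfied some-pre) , proj₂ (Any.satisfied some-post))

  copy-crossing : ∀ k t {w w'} → Pre k (t , w) → Post k (t , w') →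
    ∃[ x ] ∃[ y ] (E H x y × Pre k (t , x) × Post k (t , y))
  copy-crossing k t {w} {w'} = walk-crossing (λ x → pre⊎post k (t , x)) pre∩post=∅ (conn w w')

  module _ (Rg : Region {R}) (k : ℕ) where
    open Region Rg

    fibre-crossing : ∀ w {t₀ t₁} → Mem t₀ → Mem t₁ → Pre k (t₀ , w) → Post k (t₁ , w) →
      ∃[ a ] ∃[ b ] (TreeE R (proj₁ a) (proj₁ b) × Pre k (proj₁ a , w) × Post k (proj₁ b , w))
    fibre-crossing w t₀∈ t₁∈ pre₀ post₁ with pre⊎post k (hub , w)
    ... | inj₂ post-hub =
      walk-crossing (λ a → pre⊎post k (proj₁ a , w)) pre∩post=∅ (proj₂ (walk-to-hub Rg t₀∈)) pre₀ post-hub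
    ... | inj₁ pre-hub
      with walk-crossing (λ a → Sum.swap (pre⊎post k (proj₁ a , w))) (λ post pre → pre∩post=∅ pre post)
                         (proj₂ (walk-to-hub Rg t₁∈)) post₁ pre-hub
    ...   | b , a , b–a , post-b , pre-a = a , b , TreeE-sym {R} {proj₁ b} {proj₁ a} b–a , pre-a , post-b

    private
      Q : (TreeV R × V H) × (TreeV R × V H) → Set
      Q e = CrossEdge k e × Inside Mem e

      matching-from : ∀ {L : Set} (label : TreeV R × V H → L) {ls n} → Unique ls → length ls ≡ n →
        All (LabelledEdge label Q) ls → ∃[ M ] (CrossMatching k M × All (Inside Mem) M × length M ≡ n)
      matching-from label ls! |ls| es
        with matching-of-labels label Q (λ ((pre , post , _) , _) → pre≢post pre post) ls! es
      ... | M , |M| , QM , M! = M , (All.map proj₁ QM , M!) , All.map proj₂ QM , trans |M| |ls|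

    region-matching : ∀ {n} → Distinct Mem n →
      Distinct (Meets Mem (Pre k)) n → Distinct (Meets Mem (Post k)) n →
      ∃[ M ] (CrossMatching k M × All (Inside Mem) M × length M ≡ n)
    region-matching (P , P! , |P| , P∈) (A , A! , |A| , A-pre) (B , B! , |B| , B-post)
      with All.decide (classify k) P
    ... | inj₁ mixed = matching-from proj₁ P! |P| (All.zipWith copy-edge (P∈ , mixed))
      where
      copy-edge : ∀ {t} → Mem t × Mixed k t → LabelledEdge proj₁ Q t
      copy-edge (t∈ , _ , _ , pre , post) with copy-crossing k _ pre post
      ... | x , y , x–y , pre-x , post-y =
        _ , ((pre-x , post-y , inj₁ (refl , x–y)) , t∈ , t∈) , refl , refl
    ... | inj₂ pure with All.lookupAny P∈ pure
    ...   | t₀∈ , inj₁ all-pre = matching-from proj₂ B! |B| (All.map fibre-edge B-post)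
      where
      fibre-edge : ∀ {w} → Meets Mem (Post k) w → LabelledEdge proj₂ Q w
      fibre-edge {w} (_ , t∈ , post) with fibre-crossing w t₀∈ t∈ (all-pre w) post
      ... | (a , a∈) , (b , b∈) , a–b , pre-a , post-b =
        _ , ((pre-a , post-b , inj₂ (a–b , refl)) , a∈ , b∈) , refl , refl
    ...   | t₀∈ , inj₂ all-post = matching-from proj₂ A! |A| (All.map fibre-edge A-pre)
      where
      fibre-edge : ∀ {w} → Meets Mem (Pre k) w → LabelledEdge proj₂ Q w
      fibre-edge {w} (_ , t∈ , pre) with fibre-crossing w t∈ t₀∈ pre (all-post w)
      ... | (a , a∈) , (b , b∈) , a–b , pre-a , post-b =
        _ , ((pre-a , post-b , inj₂ (a–b , refl)) , a∈ , b∈) , refl , refl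

  module _ {p : ℕ} (vs! : Unique vs) (|vs| : length vs ≡ 2 * p) where

    _≟ᵥ_ : (u v : V H) → Dec (u ≡ v)
    u ≟ᵥ v = unique-enumeration-≟ vs! (vs-complete u) (vs-complete v)

    module Scan (g : TreeV R) where

      Seen : ℕ → V H → Set
      Seen k w = Any (λ v → Below (proj₁ g) (proj₁ v) × proj₂ v ≡ w) (take k σ)

      seen? : ∀ k → Decidable (Seen k)
      seen? k w = Any.any? (λ v → (proj₁ g ≼? proj₁ (proj₁ v)) ×-dec (proj₂ v ≟ᵥ w)) (take k σ)

      count : ℕ → ℕ
      count k = length (filter (seen? k) vs)

      count-0 : count 0 ≡ 0
      count-0 = cong length (filter-none (seen? 0) {vs} (All.tabulate λ _ ()))

      count-step : ∀ k → count (suc k) ≤ suc (count k)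
      count-step k = length-filter-≤-suc (seen? (suc k)) (seen? k) vs! seen-early⊎next next-unique
        where
        Next : V H → Set
        Next w = ∃[ v ] (v ∈ take 1 (drop k σ) × proj₂ v ≡ w)
        seen-early⊎next : ∀ {w} → Seen (suc k) w → Seen k w ⊎ Next w
        seen-early⊎next seen with Any.++⁻ (take k σ) (subst (Any _) (take-suc-++ k σ) seen)
        ... | inj₁ early = inj₁ early
        ... | inj₂ next with find next
        ...   | v , v∈ , _ , v↦w = inj₂ (v , v∈ , v↦w)
        next-unique : ∀ {w w'} → Next w → Next w' → w ≡ w'
        next-unique (v , v∈ , refl) (v' , v'∈ , refl) = cong proj₂ (∈-take-1-unique (drop k σ) v∈ v'∈)

      p≤count-all : p ≤ count (length σ)
      p≤count-all = begin
        p                ≤⟨ m≤m+n p (p + 0) ⟩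
        2 * p            ≡⟨ sym |vs| ⟩
        length vs        ≡⟨ cong length (sym (filter-all (seen? (length σ)) {vs} (All.tabulate λ {w} _ → seen-all w))) ⟩
        count (length σ) ∎
        where
        open ≤-Reasoning
        seen-all : ∀ w → Seen (length σ) w
        seen-all w =
          lose (subst ((g , w) ∈_) (sym (take-all (length σ) σ ≤-refl)) (σ-complete (g , w))) (≼-refl , refl)

    balanced-time : ∀ g → ∃[ k ] (Distinct (Meets (Below (proj₁ g)) (Pre k)) p ×
                                  Distinct (Meets (Below (proj₁ g)) (Post k)) p)
    balanced-time g = split-at (unit-step-ivt count count-0 count-step (length σ) p≤count-all)
      where
      open Scan g

      split-at : ∃[ k ] count k ≡ p → ∃[ k ] (Distinct (Meets (Below (proj₁ g)) (Pre k)) p ×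
                                              Distinct (Meets (Below (proj₁ g)) (Post k)) p)
      split-at (k , |seen|) =
        k , (seen , UP.filter⁺ (seen? k) vs! , |seen| , All.tabulate seen⇒meets) ,
            (unseen , UP.filter⁺ (¬? ∘ seen? k) vs! , |unseen| , All.tabulate unseen⇒meets)
        where
        seen unseen : List (V H)
        seen = filter (seen? k) vs
        unseen = filter (¬? ∘ seen? k) vs

        seen⇒meets : ∀ {w} → w ∈ seen → Meets (Below (proj₁ g)) (Pre k) w
        seen⇒meets w∈ with find (proj₂ (∈-filter⁻ (seen? k) {xs = vs} w∈))
        ... | (t , _) , v∈ , below , refl = t , below , v∈

        -- for unseen w not even (g, w) has been scanned
        unseen⇒meets : ∀ {w} → w ∈ unseen → Meets (Below (proj₁ g)) (Post k) w
        unseen⇒meets {w} w∈ with pre⊎post k (g , w)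
        ... | inj₂ post = g , ≼-refl , post
        ... | inj₁ pre = ⊥-elim (proj₂ (∈-filter⁻ (¬? ∘ seen? k) {xs = vs} w∈) (lose pre (≼-refl , refl)))

        |unseen| : length unseen ≡ p
        |unseen| = +-cancelˡ-≡ p _ _ (begin
          p + length unseen       ≡⟨ cong (_+ length unseen) (sym |seen|) ⟩
          count k + length unseen ≡⟨ length-filter+length-filter-¬ (seen? k) vs ⟩
          length vs               ≡⟨ |vs| ⟩
          2 * p                   ≡⟨ cong (p +_) (+-identityʳ p) ⟩
          p + p                   ∎)
          where open ≡-Reasoning

    record BalancedCut (j : ℕ) (s : List Bool) : Set where
      field
        time : ℕ
        pre-fibres : Distinct (Meets (Below s) (Pre time)) p
        post-fibres : Distinct (Meets (Below s) (Post time)) p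
        matching : List ((TreeV R × V H) × (TreeV R × V H))
        crossing : CrossMatching time matching
        inside : All (Inside (Below s)) matching
        large : suc j * p ≤ 2 * length matching
    open BalancedCut public

    balanced-cut-base : ∀ {j} → j ≤ 1 → ∀ s → ⌈log₂ p ⌉ + j + length s ≤ R → BalancedCut j s
    balanced-cut-base {j} j≤1 s room with balanced-time (s , m+n≤o⇒n≤o _ room)
    ... | k , pre , post
      with region-matching (subtree (s , m+n≤o⇒n≤o _ room)) k
             (distinct-descendants s (≤-trans (+-monoˡ-≤ (length s) (m≤m+n _ j)) room)) pre post
    ...   | M , M-cross , M-inside , |M| = record
      { time = k ; pre-fibres = pre ; post-fibres = post
      ; matching = M ; crossing = M-cross ; inside = M-inside
      ; large = subst (λ m → suc j * p ≤ 2 * m) (sym |M|) (*-monoˡ-≤ p (s≤s j≤1)) }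

    Candidate : ℕ → List Bool → ℕ → Set
    Candidate j s d = Σ (List Bool) λ g → s ≼ g × length g ≡ d × BalancedCut j g

    cut : ∀ {j s d} (c : Candidate j s d) → BalancedCut j (proj₁ c)
    cut (_ , _ , _ , c) = c

    balanced-cut-combine : ∀ {j s d} → length s ≤ R → ⌈log₂ p ⌉ + d ≤ R →
      ∀ (a m b : Candidate j s d) → proj₁ a ≢ proj₁ m → proj₁ b ≢ proj₁ m →
      time (cut a) ≤ time (cut m) → time (cut m) ≤ time (cut b) → BalancedCut (2 + j) s
    balanced-cut-combine {j} {s} {d} s-room room
        (ga , s≼ga , |ga| , ca) (gm , s≼gm , |gm| , cm) (gb , s≼gb , |gb| , cb) ga≢gm gb≢gm a≤m m≤b =
      extend (region-matching rest (time cm)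
               (Distinct-map (λ {t} → outside-m s≼ga |ga| ga≢gm {t})
                             (distinct-descendants ga (subst (λ n → ⌈log₂ p ⌉ + n ≤ R) (sym |ga|) room)))
               (pre-from-a (λ {t} → outside-m s≼ga |ga| ga≢gm {t}))
               (post-from-b (λ {t} → outside-m s≼gb |gb| gb≢gm {t})))
      where
      rest : Region
      rest = record
        { Mem = λ t → s ≼ proj₁ t × ¬ (gm ≼ proj₁ t)
        ; hub = s , s-room
        ; hub≼ = proj₁
        ; between = λ (_ , gm⋠t) s≼a a≼t → s≼a , λ gm≼a → gm⋠t (≼-trans gm≼a a≼t) }

      outside-m : ∀ {g} → s ≼ g → length g ≡ d → g ≢ gm → ∀ {t} → g ≼ proj₁ t → Region.Mem rest t
      outside-m s≼g |g| g≢gm g≼t =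
        ≼-trans s≼g g≼t , λ gm≼t → g≢gm (≼-ancestors-≡ g≼t gm≼t (trans |g| (sym |gm|)))

      pre-from-a : ∀ {Z} → (∀ {t} → ga ≼ proj₁ t → Z t) → Distinct (Meets Z (Pre (time cm))) p
      pre-from-a into = Distinct-map (λ (t , ga≼t , pre) → t , into {t} ga≼t , pre-mono a≤m pre) (pre-fibres ca)

      post-from-b : ∀ {Z} → (∀ {t} → gb ≼ proj₁ t → Z t) → Distinct (Meets Z (Post (time cm))) p
      post-from-b into = Distinct-map (λ (t , gb≼t , post) → t , into {t} gb≼t , post-antimono m≤b post) (post-fibres cb)

      double : ∀ n m → n + (n + 2 * m) ≡ 2 * (m + n)
      double = solve-∀

      extend : ∃[ M ] (CrossMatching (time cm) M × All (Inside (Region.Mem rest)) M × length M ≡ p) →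
        BalancedCut (2 + j) s
      extend (M , M-cross , M-inside , |M|) = record
        { time = time cm
        ; pre-fibres = pre-from-a (≼-trans s≼ga)
        ; post-fibres = post-from-b (≼-trans s≼gb)
        ; matching = matching cm ++ M
        ; crossing = crossMatching-++ (crossing cm) M-cross
                       (inside-disjoint (λ gm≼t (_ , gm⋠t) → gm⋠t gm≼t) (inside cm) M-inside)
        ; inside = AllP.++⁺ (All.map (λ (u∈ , v∈) → ≼-trans s≼gm u∈ , ≼-trans s≼gm v∈) (inside cm))
                            (All.map (λ ((u∈ , _) , (v∈ , _)) → u∈ , v∈) M-inside)
        ; large = begin
            (3 + j) * p                           ≤⟨ +-monoʳ-≤ p (+-monoʳ-≤ p (large cm)) ⟩
            p + (p + 2 * length (matching cm))    ≡⟨ double p (length (matching cm)) ⟩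
            2 * (length (matching cm) + p)        ≡⟨ cong (λ n → 2 * (length (matching cm) + n)) (sym |M|) ⟩
            2 * (length (matching cm) + length M) ≡⟨ cong (2 *_) (sym (length-++ (matching cm))) ⟩
            2 * length (matching cm ++ M)         ∎ }
        where open ≤-Reasoning

    balanced-cut-step : ∀ {j s} → length s ≤ R → ⌈log₂ p ⌉ + (2 + length s) ≤ R →
      (∀ b₁ b₂ → BalancedCut j (b₁ ∷ b₂ ∷ s)) → BalancedCut (2 + j) s
    balanced-cut-step {j} {s} s-room room cut-below =
      combine (median-of-three (λ c → time (cut c)) Apart (λ x≢y → x≢y ∘ sym)
                               {grandchild false false} {grandchild true false} {grandchild false true}
                               (λ ()) (λ ()) (λ ()))
      where
      grandchild : Bool → Bool → Candidate j s (2 + length s)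
      grandchild b₁ b₂ = b₁ ∷ b₂ ∷ s , ≼-step (≼-step ≼-refl) , refl , cut-below b₁ b₂

      Apart : Candidate j s (2 + length s) → Candidate j s (2 + length s) → Set
      Apart x y = proj₁ x ≢ proj₁ y

      combine : ∃[ a ] ∃[ m ] ∃[ b ] (Apart a m × Apart b m ×
                                     time (cut a) ≤ time (cut m) × time (cut m) ≤ time (cut b)) →
        BalancedCut (2 + j) s
      combine (a , m , b , a≢m , b≢m , a≤m , m≤b) = balanced-cut-combine s-room room a m b a≢m b≢m a≤m m≤b

    balanced-cut : ∀ j s → ⌈log₂ p ⌉ + j + length s ≤ R → BalancedCut j s
    balanced-cut 0 = balanced-cut-base z≤n
    balanced-cut 1 = balanced-cut-base ≤-refl
    balanced-cut (suc (suc j)) s room =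
      balanced-cut-step (m+n≤o⇒n≤o _ room) (≤-trans (+-monoˡ-≤ (2 + length s) (m≤m+n _ j)) room-below)
                        (λ b₁ b₂ → balanced-cut j (b₁ ∷ b₂ ∷ s) room-below)
      where
      shift : ∀ l j n → l + j + (2 + n) ≡ l + (2 + j) + n
      shift = solve-∀
      room-below : ⌈log₂ p ⌉ + j + (2 + length s) ≤ R
      room-below = subst (_≤ R) (sym (shift _ j (length s))) room

lemma4 : (p : ℕ) → 1 ≤ p → (H : Graph) → IsSimple H → Connected H → HasOrder H (2 * p) →
    (r : ℕ) → ⌈log₂ p ⌉ ≤ r →
      MwAtLeastHalfOf (TreeProd (CBT r) H) ((r + 1 ∸ ⌈log₂ p ⌉) * p)
lemma4 p _ H _ conn (vs , vs! , vs-complete , |vs|) r log≤r σ (σ! , σ-complete) =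
  time root , matching root , crossing root ,
  subst (λ n → n * p ≤ 2 * length (matching root)) (sym levels) (large root)
  where
  open Cuts vs vs-complete conn σ σ! σ-complete

  root : BalancedCut vs! |vs| (r ∸ ⌈log₂ p ⌉) []
  root = balanced-cut vs! |vs| (r ∸ ⌈log₂ p ⌉) [] (≤-reflexive (trans (+-identityʳ _) (m+[n∸m]≡n log≤r)))

  levels : r + 1 ∸ ⌈log₂ p ⌉ ≡ suc (r ∸ ⌈log₂ p ⌉)
  levels = trans (+-∸-comm 1 log≤r) (+-comm _ 1)
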